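{- Let $\Gamma$ be a set of infons and $\varphi$ an infon. If $\Gamma\not\vdash\bot$ in $\mathbf{P}$ and $\Gamma\vdash\varphi$ in $\mathbf{P}[\bot_w]$, then $\Gamma\vdash\varphi$ in $\mathbf{P}$.
   Context: Infons: fix a set $At$ of atomic infons; infons are generated by $\varphi ::= \top\mid\bot \mid At \mid (\varphi\wedge\varphi)\mid(\varphi\to\varphi)$. In $\mathbf{P}$, $\bot$ is treated as an ordinary atom with no special rule: $\Gamma\vdash\varphi$ in $\mathbf{P}$ iff there is a finite sequence ending in $\varphi$ whose members are in $\Gamma\cup\{\top\}$ or follow from earlier members by the rules: from $\varphi_1,\varphi_2$ infer $\varphi_1\wedge\varphi_2$; from $\varphi_1\wedge\varphi_2$ infer $\varphi_i$ ($i=1,2$); from $\varphi_2$ infer $\varphi_1\to\varphi_2$ (any $\varphi_1$); from $\varphi_1$ and $\varphi_1\to\varphi_2$ infer $\varphi_2$. $\mathbf{P}[\bot_w]$ has the same definition with the additional rule: from $\bot$ and $\varphi\to\psi$ infer $\psi$. -}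

module Defs where

open import Level using (Level; _⊔_; suc)
open import Data.Bool using (Bool; true; false)
open import Relation.Nullary using (¬_)
open import Relation.Binary.PropositionalEquality using (_≡_)

data Infon {a : Level} (At : Set a) : Set a where
  ⊤ᵢ  : Infon At
  ⊥ᵢ  : Infon At
  atom : At → Infon At
  _∧ᵢ_ : Infon At → Infon At → Infon At
  _⇒ᵢ_ : Infon At → Infon At → Infon At

infixr 6 _∧ᵢ_
infixr 5 _⇒ᵢ_

InfonSet : {a : Level} (At : Set a) (ℓ : Level) → Set (a ⊔ suc ℓ)
InfonSet At ℓ = Infon At → Set ℓ

-- Derivability. The Bool flag selects the system:
--   false = P,  true = P[⊥_w] (adds: from ⊥ and φ → ψ infer ψ).
-- An inductive derivation tree is equivalent to a finite derivation sequence.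
data Derives {a ℓ : Level} {At : Set a} (w : Bool) (Γ : InfonSet At ℓ)
       : Infon At → Set (a ⊔ ℓ) where
  hyp   : ∀ {φ} → Γ φ → Derives w Γ φ
  top   : Derives w Γ ⊤ᵢ
  ∧-I   : ∀ {φ₁ φ₂} → Derives w Γ φ₁ → Derives w Γ φ₂ → Derives w Γ (φ₁ ∧ᵢ φ₂)
  ∧-E₁  : ∀ {φ₁ φ₂} → Derives w Γ (φ₁ ∧ᵢ φ₂) → Derives w Γ φ₁
  ∧-E₂  : ∀ {φ₁ φ₂} → Derives w Γ (φ₁ ∧ᵢ φ₂) → Derives w Γ φ₂
  ⇒-I   : ∀ {φ₁ φ₂} → Derives w Γ φ₂ → Derives w Γ (φ₁ ⇒ᵢ φ₂)
  ⇒-E   : ∀ {φ₁ φ₂} → Derives w Γ φ₁ → Derives w Γ (φ₁ ⇒ᵢ φ₂) → Derives w Γ φ₂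
  ⊥w    : ∀ {φ ψ} → w ≡ true → Derives w Γ ⊥ᵢ → Derives w Γ (φ ⇒ᵢ ψ) → Derives w Γ ψ

_⊢P_ : {a ℓ : Level} {At : Set a} → InfonSet At ℓ → Infon At → Set (a ⊔ ℓ)
Γ ⊢P φ = Derives false Γ φ

_⊢P⊥w_ : {a ℓ : Level} {At : Set a} → InfonSet At ℓ → Infon At → Set (a ⊔ ℓ)
Γ ⊢P⊥w φ = Derives true Γ φ

infix 4 _⊢P_ _⊢P⊥w_

-- The extra rule of P[⊥_w] always has ⊥ among its premises, so a P[⊥_w]
-- derivation either contains no application of it, and is then a P derivation,
-- or already derives ⊥ in P at its first such application.
module Submission where

open import Defs
open import Level using (Level)
open import Data.Empty using (⊥-elim)
open import Data.Sum using (_⊎_; inj₁; inj₂; map₁; reduce; fromInj₁)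
open import Function using (_∘_)
open import Relation.Nullary using (¬_)

module _ {a ℓ : Level} {At : Set a} {Γ : InfonSet At ℓ} where

  private
    lift₂ : ∀ {φ₁ φ₂ ψ} → (Γ ⊢P φ₁ → Γ ⊢P φ₂ → Γ ⊢P ψ)
          → Γ ⊢P φ₁ ⊎ Γ ⊢P ⊥ᵢ → Γ ⊢P φ₂ ⊎ Γ ⊢P ⊥ᵢ → Γ ⊢P ψ ⊎ Γ ⊢P ⊥ᵢ
    lift₂ rule (inj₁ d) (inj₁ e) = inj₁ (rule d e)
    lift₂ rule (inj₂ b) _        = inj₂ b
    lift₂ rule (inj₁ _) (inj₂ b) = inj₂ b

  ⊢P⊥w⇒⊢P⊎⊢P⊥ : ∀ {φ} → Γ ⊢P⊥w φ → Γ ⊢P φ ⊎ Γ ⊢P ⊥ᵢ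
  ⊢P⊥w⇒⊢P⊎⊢P⊥ (hyp γ)     = inj₁ (hyp γ)
  ⊢P⊥w⇒⊢P⊎⊢P⊥ top         = inj₁ top
  ⊢P⊥w⇒⊢P⊎⊢P⊥ (∧-I d e)   = lift₂ ∧-I (⊢P⊥w⇒⊢P⊎⊢P⊥ d) (⊢P⊥w⇒⊢P⊎⊢P⊥ e)
  ⊢P⊥w⇒⊢P⊎⊢P⊥ (∧-E₁ d)    = map₁ ∧-E₁ (⊢P⊥w⇒⊢P⊎⊢P⊥ d)
  ⊢P⊥w⇒⊢P⊎⊢P⊥ (∧-E₂ d)    = map₁ ∧-E₂ (⊢P⊥w⇒⊢P⊎⊢P⊥ d)
  ⊢P⊥w⇒⊢P⊎⊢P⊥ (⇒-I d)     = map₁ ⇒-I (⊢P⊥w⇒⊢P⊎⊢P⊥ d)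
  ⊢P⊥w⇒⊢P⊎⊢P⊥ (⇒-E d e)   = lift₂ ⇒-E (⊢P⊥w⇒⊢P⊎⊢P⊥ d) (⊢P⊥w⇒⊢P⊎⊢P⊥ e)
  ⊢P⊥w⇒⊢P⊎⊢P⊥ (⊥w _ b _)  = inj₂ (reduce (⊢P⊥w⇒⊢P⊎⊢P⊥ b))

lemma5 : {a ℓ : Level} {At : Set a} (Γ : InfonSet At ℓ) (φ : Infon At)
         → ¬ (Γ ⊢P ⊥ᵢ) → Γ ⊢P⊥w φ → Γ ⊢P φ
lemma5 Γ φ Γ⊬⊥ d = fromInj₁ (⊥-elim ∘ Γ⊬⊥) (⊢P⊥w⇒⊢P⊎⊢P⊥ d)
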